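{- Let $\mathcal T^*$ be a binary tree maximizing $\mathcal F^+$ over all rooted trees with leaf set $V$ ($|V|=n$), and let $\mathtt{OPT}=\mathcal F^+(\mathcal T^*)$. Let $\widehat{\mathcal T^*}$ be a subtree of $\mathcal T^*$ containing more than $n/2$ leaves whose two child subtrees each contain at most $n/2$ leaves. Let $A$ be the set of leaves of the left child subtree of $\widehat{\mathcal T^*}$, $B$ the set of leaves of its right child subtree, and $C=V\setminus(A\cup B)$. Then $$\mathtt{OPT}\le \big(w(A)+w(B)+w(C)\big)(n-2)+\big(w(A,B)+w(B,C)+w(A,C)\big)\,|C|.$$
   Context: $V$ is a set of $n$ points with similarities $w_{ij}=w_{ji}\ge0$. For a rooted tree $\mathcal T$ with leaves $V$, $|\mathcal T(i,j)|$ denotes the number of leaves of the subtree rooted at the least common ancestor of $i,j$, and $\mathcal F^+(\mathcal T)=\sum_{i<j}w_{ij}(n-|\mathcal T(i,j)|)$. For $S\subseteq V$, $w(S)=\sum_{i<j,\ i,j\in S}w_{ij}$; for disjoint $S,T$, $w(S,T)=\sum_{i\in S,j\in T}w_{ij}$. -}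

module Defs where

open import Data.Nat as ℕ using (ℕ; zero; suc; _∸_)
open import Data.Fin using (Fin; toℕ)
open import Data.Fin.Properties using () renaming (_≟_ to _≟ᶠ_)
open import Data.Bool using (Bool; true; false; if_then_else_; _∧_; _∨_; not)
open import Data.List using (List; []; _∷_; _++_; length; allFin; foldr; map; concatMap; filter)
open import Data.List.Membership.DecPropositional using ()
import Data.List.Membership.DecPropositional as DecMem
open import Data.List.Membership.Propositional using (_∈_)
open import Data.List.Relation.Binary.Permutation.Propositional using (_↭_)
open import Data.Integer using (+_)
open import Data.Rational using (ℚ; 0ℚ; _+_; _*_; _/_; _≤_)
open import Data.Product using (_×_)
open import Data.Unit using (⊤)
import Data.Empty
import Data.Bool
open import Relation.Nullary using (does)

data Tree (n : ℕ) : Set where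
  leaf : Fin n → Tree n
  node : List (Tree n) → Tree n

ℕtoℚ : ℕ → ℚ
ℕtoℚ k = + k / 1

module _ {n : ℕ} where

  module M = DecMem (_≟ᶠ_ {n})

  _∈ᵇ_ : Fin n → List (Fin n) → Bool
  i ∈ᵇ xs = does (i M.∈? xs)

  mutual
    leaves : Tree n → List (Fin n)
    leaves (leaf x)  = x ∷ []
    leaves (node cs) = leavesL cs

    leavesL : List (Tree n) → List (Fin n)
    leavesL []       = []
    leavesL (c ∷ cs) = leaves c ++ leavesL cs

  mutual
    -- |T(i,j)|: number of leaves of the subtree rooted at the least common
    -- ancestor of i and j (the deepest node whose leaf set contains both).
    lcaSize : Tree n → Fin n → Fin n → ℕ
    lcaSize (leaf x)  i j = 1
    lcaSize (node cs) i j = lcaSizeL cs (length (leavesL cs)) i j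

    lcaSizeL : List (Tree n) → ℕ → Fin n → Fin n → ℕ
    lcaSizeL []       here i j = here
    lcaSizeL (c ∷ cs) here i j =
      if (i ∈ᵇ leaves c) ∧ (j ∈ᵇ leaves c)
        then lcaSize c i j
        else lcaSizeL cs here i j

  mutual
    Proper : Tree n → Set
    Proper (leaf x)           = ⊤
    Proper (node [])          = Data.Empty.⊥
    Proper (node (c ∷ []))    = Data.Empty.⊥
    Proper (node (c ∷ d ∷ cs)) = ProperL (c ∷ d ∷ cs)

    ProperL : List (Tree n) → Set
    ProperL []       = ⊤
    ProperL (c ∷ cs) = Proper c × ProperL cs

  Binary : Tree n → Set
  Binary (leaf x)                 = ⊤
  Binary (node (c ∷ d ∷ []))      = Binary c × Binary d
  Binary (node _)                 = Data.Empty.⊥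

  RootedTreeOn : Tree n → Set
  RootedTreeOn T = Proper T × (leaves T ↭ allFin n)

  data _⊑_ : Tree n → Tree n → Set where
    here  : ∀ {T} → T ⊑ T
    child : ∀ {S c cs} → c ∈ cs → S ⊑ c → S ⊑ node cs

  Set' : Set
  Set' = Fin n → Bool

  setOf : List (Fin n) → Set'
  setOf xs i = i ∈ᵇ xs

  sumℚ : List ℚ → ℚ
  sumℚ = foldr _+_ 0ℚ

  pairSum : (Fin n → Fin n → ℚ) → ℚ
  pairSum f = sumℚ (concatMap (λ i → concatMap (λ j →
    if toℕ i ℕ.<ᵇ toℕ j then f i j ∷ [] else []) (allFin n)) (allFin n))

  fullSum : (Fin n → Fin n → ℚ) → ℚ
  fullSum f = sumℚ (concatMap (λ i → map (λ j → f i j) (allFin n)) (allFin n))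

  boolℚ : Bool → ℚ → ℚ
  boolℚ b q = if b then q else 0ℚ

  F⁺ : (Fin n → Fin n → ℚ) → Tree n → ℚ
  F⁺ w T = pairSum (λ i j → w i j * ℕtoℚ (n ∸ lcaSize T i j))

  wIn : (Fin n → Fin n → ℚ) → Set' → ℚ
  wIn w S = pairSum (λ i j → boolℚ (S i ∧ S j) (w i j))

  wBetween : (Fin n → Fin n → ℚ) → Set' → Set' → ℚ
  wBetween w S T = fullSum (λ i j → boolℚ (S i ∧ T j) (w i j))

  card : Set' → ℕ
  card S = length (filter (λ i → Data.Bool._≟_ (S i) true) (allFin n))

-- For a pair i < j the factor n − |T*(i,j)| is at most n − 2, because the subtree at the least
-- common ancestor contains the two distinct leaves i and j. If moreover i and j lie in different
-- blocks of the partition V = A ∪ B ∪ C, that ancestor is the node with children a and b or lies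
-- above it, so |T*(i,j)| ≥ |A| + |B| ≥ n − |C|. Summing w_ij times the appropriate bound over all
-- pairs gives the claim: pairs inside a block contribute to w(A) + w(B) + w(C), and each pair
-- i < j across two blocks is one of the ordered pairs counted by w(A,B) + w(B,C) + w(A,C).

module Submission where

open import Defs
open import Algebra.Bundles using (CommutativeMonoid)
import Algebra.Properties.CommutativeSemigroup as CommSemigroupProperties
open import Data.Bool using (Bool; true; false; T; not; _∧_; _∨_; if_then_else_)
import Data.Bool as Bool
open import Data.Empty using (⊥; ⊥-elim)
open import Data.Fin using (Fin; toℕ)
open import Data.List using (List; []; _∷_; _++_; length; map; concatMap; allFin; foldr; filter)
open import Data.List.Membership.Propositional using (_∈_; _∉_)
open import Data.List.Membership.Propositional.Properties using (∈-++⁺ˡ; ∈-++⁺ʳ; ∈-++⁻; ∈-∃++; ∈-filter⁻; ∈-allFin)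
open import Data.List.Properties using (length-++; length-tabulate)
open import Data.List.Relation.Binary.Disjoint.Propositional using (Disjoint)
open import Data.List.Relation.Binary.Permutation.Propositional using (↭-sym; ↭⇒↭ₛ)
open import Data.List.Relation.Binary.Permutation.Propositional.Properties using (∈-resp-↭)
open import Data.List.Relation.Binary.Permutation.Setoid.Properties using (Unique-resp-↭)
open import Data.List.Relation.Binary.Subset.Propositional using (_⊆_)
open import Data.List.Relation.Unary.All as All using ()
open import Data.List.Relation.Unary.AllPairs using ([]; _∷_)
open import Data.List.Relation.Unary.Any using (here; there)
open import Data.List.Relation.Unary.Unique.Propositional using (Unique)
open import Data.List.Relation.Unary.Unique.Propositional.Properties using (allFin⁺; filter⁺)
open import Data.Nat as ℕ using (ℕ; suc; _*_; _<_; _≤_; _∸_)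
import Data.Nat.Properties as ℕₚ
import Data.Integer as ℤ
import Data.Integer.Properties as ℤₚ
open import Data.Nat.Coprimality using (1-coprimeTo) renaming (sym to Coprime-sym)
open import Data.Rational using (ℚ; 0ℚ; _+_; mkℚ; *≤*; nonNegative) renaming (_*_ to _*ℚ_; _≤_ to _≤ℚ_)
import Data.Rational.Properties as ℚₚ
open import Data.Product using (_×_; _,_; proj₂)
open import Data.Sum using (_⊎_; inj₁; inj₂)
open import Function using (_∘_)
open import Relation.Nullary using (Dec; yes; no; proof; Reflects; ofʸ; ofⁿ)
open import Relation.Binary.PropositionalEquality
  using (_≡_; _≢_; refl; sym; setoid; trans; cong; cong₂; subst; module ≡-Reasoning)

open CommSemigroupProperties (CommutativeMonoid.commutativeSemigroup ℚₚ.+-0-commutativeMonoid)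
  using (interchange)

-- Sums of rationals

-- Defs' sumℚ and boolℚ take an implicit n that they never use (so it is never inferable);
-- sum and [_]·_ are definitionally equal copies without it.
sum : List ℚ → ℚ
sum = foldr _+_ 0ℚ

sum-++ : (xs ys : List ℚ) → sum (xs ++ ys) ≡ sum xs + sum ys
sum-++ []       ys = sym (ℚₚ.+-identityˡ _)
sum-++ (x ∷ xs) ys = trans (cong (x +_) (sum-++ xs ys)) (sym (ℚₚ.+-assoc x _ _))

private variable
  X Y : Set

∑ : List X → (X → ℚ) → ℚ
∑ xs f = sum (map f xs)

sum-concatMap : (g : X → List ℚ) (xs : List X) → sum (concatMap g xs) ≡ ∑ xs (sum ∘ g)
sum-concatMap g []       = refl
sum-concatMap g (x ∷ xs) =
  trans (sum-++ (g x) _) (cong (sum (g x) +_) (sum-concatMap g xs))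

∑-cong : (xs : List X) {f g : X → ℚ} → (∀ x → f x ≡ g x) → ∑ xs f ≡ ∑ xs g
∑-cong []       f≡g = refl
∑-cong (x ∷ xs) f≡g = cong₂ _+_ (f≡g x) (∑-cong xs f≡g)

∑-zero : (xs : List X) → ∑ xs (λ _ → 0ℚ) ≡ 0ℚ
∑-zero []       = refl
∑-zero (x ∷ xs) = trans (cong (0ℚ +_) (∑-zero xs)) (ℚₚ.+-identityˡ 0ℚ)

∑-+ : (xs : List X) (f g : X → ℚ) → ∑ xs (λ x → f x + g x) ≡ ∑ xs f + ∑ xs g
∑-+ []       f g = sym (ℚₚ.+-identityˡ 0ℚ)
∑-+ (x ∷ xs) f g = trans (cong (f x + g x +_) (∑-+ xs f g)) (interchange (f x) (g x) _ _)

∑-*ʳ : (xs : List X) (f : X → ℚ) (q : ℚ) → ∑ xs f *ℚ q ≡ ∑ xs (λ x → f x *ℚ q)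
∑-*ʳ []       f q = ℚₚ.*-zeroˡ q
∑-*ʳ (x ∷ xs) f q = trans (ℚₚ.*-distribʳ-+ q (f x) _) (cong (f x *ℚ q +_) (∑-*ʳ xs f q))

∑-mono : (xs : List X) {f g : X → ℚ} → (∀ x → f x ≤ℚ g x) → ∑ xs f ≤ℚ ∑ xs g
∑-mono []       f≤g = ℚₚ.≤-refl
∑-mono (x ∷ xs) f≤g = ℚₚ.+-mono-≤ (f≤g x) (∑-mono xs f≤g)

∑-comm : (xs : List X) (ys : List Y) (f : X → Y → ℚ) →
         ∑ xs (λ x → ∑ ys (f x)) ≡ ∑ ys (λ y → ∑ xs (λ x → f x y))
∑-comm []       ys f = sym (∑-zero ys)
∑-comm (x ∷ xs) ys f =
  trans (cong (∑ ys (f x) +_) (∑-comm xs ys f)) (sym (∑-+ ys (f x) _))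

p≤p+q : ∀ {p q : ℚ} → 0ℚ ≤ℚ q → p ≤ℚ p + q
p≤p+q {p} 0≤q = ℚₚ.≤-trans (ℚₚ.≤-reflexive (sym (ℚₚ.+-identityʳ p))) (ℚₚ.+-monoʳ-≤ p 0≤q)

q≤p+q : ∀ {p q : ℚ} → 0ℚ ≤ℚ p → q ≤ℚ p + q
q≤p+q {p} {q} 0≤p = ℚₚ.≤-trans (ℚₚ.≤-reflexive (sym (ℚₚ.+-identityˡ q))) (ℚₚ.+-monoˡ-≤ q 0≤p)

0≤* : ∀ {p q : ℚ} → 0ℚ ≤ℚ p → 0ℚ ≤ℚ q → 0ℚ ≤ℚ p *ℚ q
0≤* {p} {q} 0≤p 0≤q =
  ℚₚ.nonNegative⁻¹ _ {{ℚₚ.nonNeg*nonNeg⇒nonNeg p {{nonNegative 0≤p}} q {{nonNegative 0≤q}}}}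

[_]·_ : Bool → ℚ → ℚ
[ b ]· x = if b then x else 0ℚ

infix 8 [_]·_

[]·-+ : ∀ b (x y : ℚ) → [ b ]· (x + y) ≡ [ b ]· x + [ b ]· y
[]·-+ true  x y = refl
[]·-+ false x y = sym (ℚₚ.+-identityˡ 0ℚ)

[]·-*ʳ : ∀ b (x q : ℚ) → [ b ]· x *ℚ q ≡ [ b ]· (x *ℚ q)
[]·-*ʳ true  x q = refl
[]·-*ʳ false x q = ℚₚ.*-zeroˡ q

[]·-nonNeg : ∀ b {x : ℚ} → 0ℚ ≤ℚ x → 0ℚ ≤ℚ [ b ]· x
[]·-nonNeg true  0≤x = 0≤x
[]·-nonNeg false 0≤x = ℚₚ.≤-refl

[]·-mono : ∀ b {x y : ℚ} → (T b → x ≤ℚ y) → [ b ]· x ≤ℚ [ b ]· y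
[]·-mono true  x≤y = x≤y _
[]·-mono false x≤y = ℚₚ.≤-refl

T⇒≤[]· : ∀ {b} {x : ℚ} → T b → x ≤ℚ [ b ]· x
T⇒≤[]· {true} _ = ℚₚ.≤-refl

[]·-∨-≤ : ∀ b c {x s t : ℚ} → 0ℚ ≤ℚ x → [ b ]· x ≤ℚ s → [ c ]· x ≤ℚ t → [ b ∨ c ]· x ≤ℚ s + t
[]·-∨-≤ b c {x} {s} {t} 0≤x bx≤s cx≤t = ℚₚ.≤-trans (∨-≤-+ b c) (ℚₚ.+-mono-≤ bx≤s cx≤t)
  where
  ∨-≤-+ : ∀ b c → [ b ∨ c ]· x ≤ℚ [ b ]· x + [ c ]· x
  ∨-≤-+ true  true  = p≤p+q 0≤x
  ∨-≤-+ true  false = ℚₚ.≤-reflexive (sym (ℚₚ.+-identityʳ x))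
  ∨-≤-+ false true  = ℚₚ.≤-reflexive (sym (ℚₚ.+-identityˡ x))
  ∨-≤-+ false false = ℚₚ.≤-refl

sum-singleton-if : ∀ b (x : ℚ) → sum (if b then x ∷ [] else []) ≡ [ b ]· x
sum-singleton-if true  x = ℚₚ.+-identityʳ x
sum-singleton-if false x = refl

[]·-+-≤ : ∀ b c {x : ℚ} → 0ℚ ≤ℚ x → (T b → T c → ⊥) → [ b ]· x + [ c ]· x ≤ℚ x
[]·-+-≤ true  true  0≤x excl = ⊥-elim (excl _ _)
[]·-+-≤ true  false 0≤x excl = ℚₚ.≤-reflexive (ℚₚ.+-identityʳ _)
[]·-+-≤ false true  0≤x excl = ℚₚ.≤-reflexive (ℚₚ.+-identityˡ _)
[]·-+-≤ false false 0≤x excl = 0≤x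

module _ {n : ℕ} where

  ∑∑ : (Fin n → Fin n → ℚ) → ℚ
  ∑∑ f = ∑ (allFin n) λ i → ∑ (allFin n) (f i)

  ∑∑-cong : {f g : Fin n → Fin n → ℚ} → (∀ i j → f i j ≡ g i j) → ∑∑ f ≡ ∑∑ g
  ∑∑-cong f≡g = ∑-cong (allFin n) λ i → ∑-cong (allFin n) (f≡g i)

  ∑∑-+ : (f g : Fin n → Fin n → ℚ) → ∑∑ (λ i j → f i j + g i j) ≡ ∑∑ f + ∑∑ g
  ∑∑-+ f g = trans (∑-cong (allFin n) λ i → ∑-+ (allFin n) (f i) (g i)) (∑-+ (allFin n) _ _)

  ∑∑-*ʳ : (f : Fin n → Fin n → ℚ) (q : ℚ) → ∑∑ f *ℚ q ≡ ∑∑ (λ i j → f i j *ℚ q)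
  ∑∑-*ʳ f q = trans (∑-*ʳ (allFin n) _ q) (∑-cong (allFin n) λ i → ∑-*ʳ (allFin n) (f i) q)

  ∑∑-mono : {f g : Fin n → Fin n → ℚ} → (∀ i j → f i j ≤ℚ g i j) → ∑∑ f ≤ℚ ∑∑ g
  ∑∑-mono f≤g = ∑-mono (allFin n) λ i → ∑-mono (allFin n) (f≤g i)

  ∑∑-transpose : (f : Fin n → Fin n → ℚ) → ∑∑ f ≡ ∑∑ (λ i j → f j i)
  ∑∑-transpose f = ∑-comm (allFin n) (allFin n) f

  ordered : Fin n → Fin n → Bool
  ordered i j = toℕ i ℕ.<ᵇ toℕ j

  ordered⇒< : ∀ i j → T (ordered i j) → toℕ i < toℕ j
  ordered⇒< i j = ℕₚ.<ᵇ⇒< (toℕ i) (toℕ j)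

  pairSum-∑∑ : (f : Fin n → Fin n → ℚ) → pairSum f ≡ ∑∑ (λ i j → [ ordered i j ]· f i j)
  pairSum-∑∑ f =
    trans (sum-concatMap _ (allFin n)) (∑-cong (allFin n) λ i →
      trans (sum-concatMap _ (allFin n)) (∑-cong (allFin n) λ j →
        sum-singleton-if (ordered i j) (f i j)))

  fullSum-∑∑ : (f : Fin n → Fin n → ℚ) → fullSum f ≡ ∑∑ f
  fullSum-∑∑ f = sum-concatMap _ (allFin n)

  pairSum-+ : (f g : Fin n → Fin n → ℚ) → pairSum (λ i j → f i j + g i j) ≡ pairSum f + pairSum g
  pairSum-+ f g = begin
    pairSum (λ i j → f i j + g i j)
      ≡⟨ pairSum-∑∑ _ ⟩
    ∑∑ (λ i j → [ ordered i j ]· (f i j + g i j))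
      ≡⟨ ∑∑-cong (λ i j → []·-+ (ordered i j) (f i j) (g i j)) ⟩
    ∑∑ (λ i j → [ ordered i j ]· f i j + [ ordered i j ]· g i j)
      ≡⟨ ∑∑-+ _ _ ⟩
    ∑∑ (λ i j → [ ordered i j ]· f i j) + ∑∑ (λ i j → [ ordered i j ]· g i j)
      ≡⟨ sym (cong₂ _+_ (pairSum-∑∑ f) (pairSum-∑∑ g)) ⟩
    pairSum f + pairSum g ∎
    where open ≡-Reasoning

  pairSum-+₃ : (f g h : Fin n → Fin n → ℚ) →
              pairSum (λ i j → f i j + g i j + h i j) ≡ pairSum f + pairSum g + pairSum h
  pairSum-+₃ f g h = trans (pairSum-+ _ h) (cong (_+ pairSum h) (pairSum-+ f g))

  pairSum-*ʳ : (f : Fin n → Fin n → ℚ) (q : ℚ) → pairSum f *ℚ q ≡ pairSum (λ i j → f i j *ℚ q)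
  pairSum-*ʳ f q = begin
    pairSum f *ℚ q
      ≡⟨ cong (_*ℚ q) (pairSum-∑∑ f) ⟩
    ∑∑ (λ i j → [ ordered i j ]· f i j) *ℚ q
      ≡⟨ ∑∑-*ʳ _ q ⟩
    ∑∑ (λ i j → [ ordered i j ]· f i j *ℚ q)
      ≡⟨ ∑∑-cong (λ i j → []·-*ʳ (ordered i j) (f i j) q) ⟩
    ∑∑ (λ i j → [ ordered i j ]· (f i j *ℚ q))
      ≡⟨ sym (pairSum-∑∑ _) ⟩
    pairSum (λ i j → f i j *ℚ q) ∎
    where open ≡-Reasoning

  pairSum-mono : {f g : Fin n → Fin n → ℚ} →
                 (∀ i j → toℕ i < toℕ j → f i j ≤ℚ g i j) → pairSum f ≤ℚ pairSum g
  pairSum-mono {f} {g} f≤g = begin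
    pairSum f                              ≡⟨ pairSum-∑∑ f ⟩
    ∑∑ (λ i j → [ ordered i j ]· f i j)  ≤⟨ ∑∑-mono (λ i j → []·-mono (ordered i j) (f≤g i j ∘ ordered⇒< i j)) ⟩
    ∑∑ (λ i j → [ ordered i j ]· g i j)  ≡⟨ sym (pairSum-∑∑ g) ⟩
    pairSum g                              ∎
    where open ℚₚ.≤-Reasoning

  pairSum-symmetrised-≤-fullSum : (f : Fin n → Fin n → ℚ) → (∀ i j → 0ℚ ≤ℚ f i j) →
                                  pairSum (λ i j → f i j + f j i) ≤ℚ fullSum f
  pairSum-symmetrised-≤-fullSum f 0≤f = begin
    pairSum (λ i j → f i j + f j i)
      ≡⟨ pairSum-+ f (λ i j → f j i) ⟩
    pairSum f + pairSum (λ i j → f j i)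
      ≡⟨ cong₂ _+_ (pairSum-∑∑ f) (trans (pairSum-∑∑ _) (∑∑-transpose _)) ⟩
    ∑∑ (λ i j → [ ordered i j ]· f i j) + ∑∑ (λ i j → [ ordered j i ]· f i j)
      ≡⟨ sym (∑∑-+ _ _) ⟩
    ∑∑ (λ i j → [ ordered i j ]· f i j + [ ordered j i ]· f i j)
      ≤⟨ ∑∑-mono (λ i j → []·-+-≤ (ordered i j) (ordered j i) (0≤f i j) (ordered-asym i j)) ⟩
    ∑∑ f
      ≡⟨ sym (fullSum-∑∑ f) ⟩
    fullSum f ∎
    where
    open ℚₚ.≤-Reasoning
    ordered-asym : ∀ i j → T (ordered i j) → T (ordered j i) → ⊥
    ordered-asym i j i<j j<i = ℕₚ.<-asym (ordered⇒< i j i<j) (ordered⇒< j i j<i)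

*-≤-split : ∀ {x s c ℓ q r : ℚ} → 0ℚ ≤ℚ s → 0ℚ ≤ℚ c → 0ℚ ≤ℚ ℓ → 0ℚ ≤ℚ r → ℓ ≤ℚ q →
            x ≤ℚ s ⊎ (x ≤ℚ c × ℓ ≤ℚ r) → x *ℚ ℓ ≤ℚ s *ℚ q + c *ℚ r
*-≤-split {x} {s} {c} {ℓ} {q} {r} 0≤s 0≤c 0≤ℓ 0≤r ℓ≤q (inj₁ x≤s) = begin
  x *ℚ ℓ            ≤⟨ ℚₚ.*-monoʳ-≤-nonNeg ℓ {{nonNegative 0≤ℓ}} x≤s ⟩
  s *ℚ ℓ            ≤⟨ ℚₚ.*-monoˡ-≤-nonNeg s {{nonNegative 0≤s}} ℓ≤q ⟩
  s *ℚ q            ≤⟨ p≤p+q (0≤* 0≤c 0≤r) ⟩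
  s *ℚ q + c *ℚ r   ∎
  where open ℚₚ.≤-Reasoning
*-≤-split {x} {s} {c} {ℓ} {q} {r} 0≤s 0≤c 0≤ℓ 0≤r ℓ≤q (inj₂ (x≤c , ℓ≤r)) = begin
  x *ℚ ℓ            ≤⟨ ℚₚ.*-monoʳ-≤-nonNeg ℓ {{nonNegative 0≤ℓ}} x≤c ⟩
  c *ℚ ℓ            ≤⟨ ℚₚ.*-monoˡ-≤-nonNeg c {{nonNegative 0≤c}} ℓ≤r ⟩
  c *ℚ r            ≤⟨ q≤p+q (0≤* 0≤s (ℚₚ.≤-trans 0≤ℓ ℓ≤q)) ⟩
  s *ℚ q + c *ℚ r   ∎
  where open ℚₚ.≤-Reasoning

ℕtoℚ≡mkℚ : ∀ k → ℕtoℚ k ≡ mkℚ (ℤ.+ k) 0 (Coprime-sym (1-coprimeTo k))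
ℕtoℚ≡mkℚ k = ℚₚ.normalize-coprime (Coprime-sym (1-coprimeTo k))

ℕtoℚ-mono-≤ : ∀ {k l} → k ≤ l → ℕtoℚ k ≤ℚ ℕtoℚ l
ℕtoℚ-mono-≤ {k} {l} k≤l rewrite ℕtoℚ≡mkℚ k | ℕtoℚ≡mkℚ l =
  *≤* (ℤₚ.*-monoʳ-≤-nonNeg (ℤ.+ 1) (ℤ.+≤+ k≤l))

0≤ℕtoℚ : ∀ k → 0ℚ ≤ℚ ℕtoℚ k
0≤ℕtoℚ k = ℕtoℚ-mono-≤ {0} {k} ℕ.z≤n

-- Uniqueness and lengths of lists

Unique-++⁻ˡ : (xs : List X) {ys : List X} → Unique (xs ++ ys) → Unique xs
Unique-++⁻ˡ []       _           = []
Unique-++⁻ˡ (x ∷ xs) (x∉ ∷ uniq) = All.tabulate (λ v∈xs → All.lookup x∉ (∈-++⁺ˡ v∈xs)) ∷ Unique-++⁻ˡ xs uniq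

Unique-++⁻ʳ : (xs : List X) {ys : List X} → Unique (xs ++ ys) → Unique ys
Unique-++⁻ʳ []       uniq       = uniq
Unique-++⁻ʳ (x ∷ xs) (_ ∷ uniq) = Unique-++⁻ʳ xs uniq

Unique-++⇒Disjoint : (xs : List X) {ys : List X} → Unique (xs ++ ys) → Disjoint xs ys
Unique-++⇒Disjoint (x ∷ xs) (x∉ ∷ _) (here refl , x∈ys) = All.lookup x∉ (∈-++⁺ʳ xs x∈ys) refl
Unique-++⇒Disjoint (x ∷ xs) (_ ∷ uniq) (there v∈xs , v∈ys) = Unique-++⇒Disjoint xs uniq (v∈xs , v∈ys)

Unique-⊆⇒length-≤ : {xs ys : List X} → Unique xs → xs ⊆ ys → length xs ≤ length ys
Unique-⊆⇒length-≤ {xs = []}     _           _     = ℕ.z≤n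
Unique-⊆⇒length-≤ {xs = x ∷ xs} (x∉ ∷ uniq) x∷xs⊆ys with ∈-∃++ (x∷xs⊆ys (here refl))
... | us , vs , refl = begin
  suc (length xs)              ≤⟨ ℕ.s≤s (Unique-⊆⇒length-≤ uniq xs⊆us++vs) ⟩
  suc (length (us ++ vs))      ≡⟨ cong suc (length-++ us) ⟩
  suc (length us ℕ.+ length vs) ≡⟨ sym (ℕₚ.+-suc (length us) (length vs)) ⟩
  length us ℕ.+ suc (length vs) ≡⟨ sym (length-++ us) ⟩
  length (us ++ x ∷ vs)        ∎
  where
  open ℕₚ.≤-Reasoning
  xs⊆us++vs : xs ⊆ us ++ vs
  xs⊆us++vs v∈xs with ∈-++⁻ us (x∷xs⊆ys (there v∈xs))
  ... | inj₁ v∈us          = ∈-++⁺ˡ v∈us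
  ... | inj₂ (here refl)   = ⊥-elim (All.lookup x∉ v∈xs refl)
  ... | inj₂ (there v∈vs) = ∈-++⁺ʳ us v∈vs

distinct-∈⇒2≤length : (xs : List X) {x y : X} → x ∈ xs → y ∈ xs → x ≢ y → 2 ≤ length xs
distinct-∈⇒2≤length (v ∷ [])     (here refl) (here refl) x≢y = ⊥-elim (x≢y refl)
distinct-∈⇒2≤length (v ∷ w ∷ xs) _           _           _   = ℕ.s≤s (ℕ.s≤s ℕ.z≤n)

length-filter-complement : (g : X → Bool) (xs : List X) →
  length (filter (λ x → g x Bool.≟ true) xs) ℕ.+ length (filter (λ x → not (g x) Bool.≟ true) xs)
    ≡ length xs
length-filter-complement g []       = refl
length-filter-complement g (x ∷ xs) with g x
... | true  = cong suc (length-filter-complement g xs)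
... | false = trans (ℕₚ.+-suc _ _) (cong suc (length-filter-complement g xs))

-- Leaves and least common ancestors

module _ {n : ℕ} where

  ∈-leavesL⁺ : ∀ {c cs} {i : Fin n} → c ∈ cs → i ∈ leaves c → i ∈ leavesL cs
  ∈-leavesL⁺ {cs = c ∷ cs} (here refl) i∈c = ∈-++⁺ˡ i∈c
  ∈-leavesL⁺ {cs = c ∷ cs} (there c∈cs) i∈c = ∈-++⁺ʳ (leaves c) (∈-leavesL⁺ c∈cs i∈c)

  mutual
    lcaSize-comm : (T : Tree n) (i j : Fin n) → lcaSize T i j ≡ lcaSize T j i
    lcaSize-comm (leaf x)  i j = refl
    lcaSize-comm (node cs) i j = lcaSizeL-comm cs _ i j

    lcaSizeL-comm : (cs : List (Tree n)) (h : ℕ) (i j : Fin n) → lcaSizeL cs h i j ≡ lcaSizeL cs h j i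
    lcaSizeL-comm []       h i j = refl
    lcaSizeL-comm (c ∷ cs) h i j with i M.∈? leaves c | j M.∈? leaves c
    ... | yes _ | yes _ = lcaSize-comm c i j
    ... | yes _ | no  _ = lcaSizeL-comm cs h i j
    ... | no  _ | yes _ = lcaSizeL-comm cs h i j
    ... | no  _ | no  _ = lcaSizeL-comm cs h i j

  length-leaves-≤-leavesL : ∀ {c cs} → c ∈ cs → length (leaves {n} c) ≤ length (leavesL cs)
  length-leaves-≤-leavesL {cs = c ∷ cs} (here refl) =
    subst (length (leaves c) ≤_) (sym (length-++ (leaves c))) (ℕₚ.m≤m+n _ _)
  length-leaves-≤-leavesL {cs = c ∷ cs} (there c∈cs) =
    subst (_ ≤_) (sym (length-++ (leaves c))) (ℕₚ.m≤n⇒m≤o+n _ (length-leaves-≤-leavesL c∈cs))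

  Unique-leavesL⇒leaves : ∀ {c cs} → c ∈ cs → Unique (leavesL {n} cs) → Unique (leaves c)
  Unique-leavesL⇒leaves {cs = c ∷ cs} (here refl)  uniq = Unique-++⁻ˡ (leaves c) uniq
  Unique-leavesL⇒leaves {cs = c ∷ cs} (there c∈cs) uniq = Unique-leavesL⇒leaves c∈cs (Unique-++⁻ʳ (leaves c) uniq)

  ∈-leaves-⊑ : ∀ {S T} {i : Fin n} → S ⊑ T → i ∈ leaves S → i ∈ leaves T
  ∈-leaves-⊑ here             i∈S = i∈S
  ∈-leaves-⊑ (child c∈cs S⊑c) i∈S = ∈-leavesL⁺ c∈cs (∈-leaves-⊑ S⊑c i∈S)

  length-leaves-⊑ : ∀ {S T : Tree n} → S ⊑ T → length (leaves S) ≤ length (leaves T)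
  length-leaves-⊑ here             = ℕₚ.≤-refl
  length-leaves-⊑ (child c∈cs S⊑c) = ℕₚ.≤-trans (length-leaves-⊑ S⊑c) (length-leaves-≤-leavesL c∈cs)

  Unique-leaves-⊑ : ∀ {S T : Tree n} → S ⊑ T → Unique (leaves T) → Unique (leaves S)
  Unique-leaves-⊑ here             uniq = uniq
  Unique-leaves-⊑ (child c∈cs S⊑c) uniq = Unique-leaves-⊑ S⊑c (Unique-leavesL⇒leaves c∈cs uniq)

  mutual
    2≤lcaSize : (T : Tree n) {i j : Fin n} → i ∈ leaves T → j ∈ leaves T → i ≢ j → 2 ≤ lcaSize T i j
    2≤lcaSize (leaf x)  (here refl) (here refl) i≢j = ⊥-elim (i≢j refl)
    2≤lcaSize (node cs) i∈T j∈T i≢j = 2≤lcaSizeL cs (distinct-∈⇒2≤length (leavesL cs) i∈T j∈T i≢j) i≢j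

    2≤lcaSizeL : (cs : List (Tree n)) {h : ℕ} {i j : Fin n} → 2 ≤ h → i ≢ j → 2 ≤ lcaSizeL cs h i j
    2≤lcaSizeL []       2≤h i≢j = 2≤h
    2≤lcaSizeL (c ∷ cs) {i = i} {j} 2≤h i≢j with i M.∈? leaves c | j M.∈? leaves c
    ... | yes i∈c | yes j∈c = 2≤lcaSize c i∈c j∈c i≢j
    ... | yes _   | no  _   = 2≤lcaSizeL cs 2≤h i≢j
    ... | no  _   | _       = 2≤lcaSizeL cs 2≤h i≢j

  Separates : List (Tree n) → Fin n → Fin n → Set
  Separates cs i j = ∀ {c} → c ∈ cs → i ∈ leaves c → j ∈ leaves c → ⊥

  lcaSizeL-separated : ∀ cs {h} {i j : Fin n} → Separates cs i j → lcaSizeL cs h i j ≡ h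
  lcaSizeL-separated []       sep = refl
  lcaSizeL-separated (c ∷ cs) {i = i} {j} sep with i M.∈? leaves c | j M.∈? leaves c
  ... | yes i∈c | yes j∈c = ⊥-elim (sep (here refl) i∈c j∈c)
  ... | yes _   | no  _   = lcaSizeL-separated cs (sep ∘ there)
  ... | no  _   | _       = lcaSizeL-separated cs (sep ∘ there)

  -- Since the leaves are unique, the only child that can hold both i and j is the one holding i.
  lcaSizeL-≥ : ∀ {c} cs {h l} {i j : Fin n} → c ∈ cs → Unique (leavesL cs) → i ∈ leaves c → l ≤ h →
               (j ∈ leaves c → l ≤ lcaSize c i j) → l ≤ lcaSizeL cs h i j
  lcaSizeL-≥ (c ∷ cs) {i = i} {j} (here refl) uniq i∈c l≤h l≤lca with i M.∈? leaves c | j M.∈? leaves c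
  ... | yes _   | yes j∈c = l≤lca j∈c
  ... | yes _   | no  _   = subst (_ ≤_) (sym (lcaSizeL-separated cs only-c)) l≤h
    where
    only-c : Separates cs i j
    only-c d∈cs i∈d _ = Unique-++⇒Disjoint (leaves c) uniq (i∈c , ∈-leavesL⁺ d∈cs i∈d)
  ... | no  i∉c | _       = ⊥-elim (i∉c i∈c)
  lcaSizeL-≥ (d ∷ cs) {i = i} (there c∈cs) uniq i∈c l≤h l≤lca with i M.∈? leaves d
  ... | yes i∈d = ⊥-elim (Unique-++⇒Disjoint (leaves d) uniq (i∈d , ∈-leavesL⁺ c∈cs i∈c))
  ... | no  _   = lcaSizeL-≥ cs c∈cs (Unique-++⁻ʳ (leaves d) uniq) i∈c l≤h l≤lca

  separated⇒length≤lcaSize : ∀ {cs T} {i j : Fin n} → node cs ⊑ T → Unique (leaves T) →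
                             i ∈ leavesL cs → Separates cs i j → length (leavesL cs) ≤ lcaSize T i j
  separated⇒length≤lcaSize {cs} here uniq i∈cs sep = ℕₚ.≤-reflexive (sym (lcaSizeL-separated cs sep))
  separated⇒length≤lcaSize (child {cs = ds} c∈ds S⊑c) uniq i∈cs sep =
    lcaSizeL-≥ ds c∈ds uniq (∈-leaves-⊑ S⊑c i∈cs) (length-leaves-⊑ (child c∈ds S⊑c))
      (λ _ → separated⇒length≤lcaSize S⊑c (Unique-leavesL⇒leaves c∈ds uniq) i∈cs sep)

-- The partition of V cut out by a node with two children

-- ai and bi indicate i ∈ A and i ∈ B, so i ∈ C iff both are false. When the bits come from a
-- partition, sameBlockᵇ says that i and j lie in the same block and crossBlockᵇ that they do not.
sameBlockᵇ : (ai bi aj bj : Bool) → Bool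
sameBlockᵇ ai bi aj bj = (ai ∧ aj ∨ bi ∧ bj) ∨ not (ai ∨ bi) ∧ not (aj ∨ bj)

crossBlockᵇ : (ai bi aj bj : Bool) → Bool
crossBlockᵇ ai bi aj bj =
  ((ai ∧ bj ∨ aj ∧ bi) ∨ (bi ∧ not (aj ∨ bj) ∨ bj ∧ not (ai ∨ bi)))
    ∨ (ai ∧ not (aj ∨ bj) ∨ aj ∧ not (ai ∨ bi))

module _ (ai bi aj bj : Bool) {x : ℚ} (0≤x : 0ℚ ≤ℚ x) where

  sameBlock-≤ : [ sameBlockᵇ ai bi aj bj ]· x ≤ℚ
                [ ai ∧ aj ]· x + [ bi ∧ bj ]· x + [ not (ai ∨ bi) ∧ not (aj ∨ bj) ]· x
  sameBlock-≤ =
    []·-∨-≤ (ai ∧ aj ∨ bi ∧ bj) _ 0≤x ([]·-∨-≤ (ai ∧ aj) (bi ∧ bj) 0≤x ℚₚ.≤-refl ℚₚ.≤-refl) ℚₚ.≤-refl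

  crossBlock-≤ : {y : ℚ} → x ≤ℚ y → [ crossBlockᵇ ai bi aj bj ]· x ≤ℚ
                 ([ ai ∧ bj ]· x + [ aj ∧ bi ]· y)
                 + ([ bi ∧ not (aj ∨ bj) ]· x + [ bj ∧ not (ai ∨ bi) ]· y)
                 + ([ ai ∧ not (aj ∨ bj) ]· x + [ aj ∧ not (ai ∨ bi) ]· y)
  crossBlock-≤ {y} x≤y =
    []·-∨-≤ (ab ∨ bc) ac 0≤x ([]·-∨-≤ ab bc 0≤x (both (ai ∧ bj) _) (both (bi ∧ cj) _)) (both (ai ∧ cj) _)
    where
    ci cj ab bc ac : Bool
    ci = not (ai ∨ bi)
    cj = not (aj ∨ bj)
    ab = ai ∧ bj ∨ aj ∧ bi
    bc = bi ∧ cj ∨ bj ∧ ci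
    ac = ai ∧ cj ∨ aj ∧ ci
    both : ∀ b c → [ b ∨ c ]· x ≤ℚ [ b ]· x + [ c ]· y
    both b c = []·-∨-≤ b c 0≤x ℚₚ.≤-refl ([]·-mono c (λ _ → x≤y))

module NodePartition {n : ℕ} (𝒯 : Tree n) (𝒯-unique : Unique (leaves 𝒯)) (𝒯-covers : ∀ i → i ∈ leaves 𝒯)
             (a b : Tree n) (ab⊑𝒯 : node (a ∷ b ∷ []) ⊑ 𝒯) where

  H : Tree n
  H = node (a ∷ b ∷ [])

  A B C : Set'
  A = setOf (leaves a)
  B = setOf (leaves b)
  C i = not (A i ∨ B i)

  a-b-disjoint : Disjoint (leaves a) (leaves b)
  a-b-disjoint (i∈a , i∈b) =
    Unique-++⇒Disjoint (leaves a) (Unique-leaves-⊑ ab⊑𝒯 𝒯-unique) (i∈a , ∈-++⁺ˡ i∈b)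

  data Part (i : Fin n) : Bool → Bool → Set where
    inA : i ∈ leaves a → Part i true false
    inB : i ∈ leaves b → Part i false true
    inC : i ∉ leaves a → i ∉ leaves b → Part i false false

  part : ∀ i → Part i (A i) (B i)
  part i = fromReflects (proof (i M.∈? leaves a)) (proof (i M.∈? leaves b))
    where
    fromReflects : ∀ {ai bi} → Reflects (i ∈ leaves a) ai → Reflects (i ∈ leaves b) bi → Part i ai bi
    fromReflects (ofʸ i∈a) (ofʸ i∈b) = ⊥-elim (a-b-disjoint (i∈a , i∈b))
    fromReflects (ofʸ i∈a) (ofⁿ _)   = inA i∈a
    fromReflects (ofⁿ _)   (ofʸ i∈b) = inB i∈b
    fromReflects (ofⁿ i∉a) (ofⁿ i∉b) = inC i∉a i∉b

  a⊆H : leaves a ⊆ leaves H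
  a⊆H = ∈-++⁺ˡ

  b⊆H : leaves b ⊆ leaves H
  b⊆H = ∈-++⁺ʳ (leaves a) ∘ ∈-++⁺ˡ

  Part-∨⇒∈H : ∀ {i ai bi} → Part i ai bi → ai ∨ bi ≡ true → i ∈ leaves H
  Part-∨⇒∈H (inA i∈a) _ = a⊆H i∈a
  Part-∨⇒∈H (inB i∈b) _ = b⊆H i∈b

  n≤|H|+|C| : n ≤ length (leaves H) ℕ.+ card C
  n≤|H|+|C| = begin
    n                                                  ≡⟨ sym (length-tabulate (λ i → i)) ⟩
    length (allFin n)                                  ≡⟨ sym (length-filter-complement A∪B (allFin n)) ⟩
    length (filter A∪B? (allFin n)) ℕ.+ card C         ≤⟨ ℕₚ.+-monoˡ-≤ (card C) (Unique-⊆⇒length-≤ A∪B-unique A∪B⊆H) ⟩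
    length (leaves H) ℕ.+ card C                       ∎
    where
    open ℕₚ.≤-Reasoning
    A∪B : Set'
    A∪B i = A i ∨ B i
    A∪B? : ∀ i → Dec (A∪B i ≡ true)
    A∪B? i = A∪B i Bool.≟ true
    A∪B-unique : Unique (filter A∪B? (allFin n))
    A∪B-unique = filter⁺ A∪B? (allFin⁺ n)
    A∪B⊆H : filter A∪B? (allFin n) ⊆ leaves H
    A∪B⊆H {i} i∈A∪B = Part-∨⇒∈H (part i) (proj₂ (∈-filter⁻ A∪B? {xs = allFin n} i∈A∪B))

  separated⇒n∸lcaSize≤|C| : ∀ {i j} → i ∈ leaves H → Separates (a ∷ b ∷ []) i j →
                            n ∸ lcaSize 𝒯 i j ≤ card C
  separated⇒n∸lcaSize≤|C| i∈H sep =
    ℕₚ.≤-trans (ℕₚ.∸-monoʳ-≤ n (separated⇒length≤lcaSize ab⊑𝒯 𝒯-unique i∈H sep))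
               (ℕₚ.m≤n+o⇒m∸n≤o n (length (leaves H)) n≤|H|+|C|)

  separated⇒n∸lcaSize≤|C|′ : ∀ {i j} → j ∈ leaves H → Separates (a ∷ b ∷ []) j i →
                             n ∸ lcaSize 𝒯 i j ≤ card C
  separated⇒n∸lcaSize≤|C|′ {i} {j} j∈H sep =
    subst (λ k → n ∸ k ≤ card C) (lcaSize-comm 𝒯 j i) (separated⇒n∸lcaSize≤|C| j∈H sep)

  a-b-separated : ∀ {i j} → i ∈ leaves a → j ∈ leaves b → Separates (a ∷ b ∷ []) i j
  a-b-separated i∈a j∈b (here refl)         _   j∈a = a-b-disjoint (j∈a , j∈b)
  a-b-separated i∈a j∈b (there (here refl)) i∈b _   = a-b-disjoint (i∈a , i∈b)

  outside-separated : ∀ {i j} → j ∉ leaves a → j ∉ leaves b → Separates (a ∷ b ∷ []) i j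
  outside-separated j∉a j∉b (here refl)         _ j∈a = j∉a j∈a
  outside-separated j∉a j∉b (there (here refl)) _ j∈b = j∉b j∈b

  classify : ∀ {i j ai bi aj bj} → Part i ai bi → Part j aj bj →
             T (sameBlockᵇ ai bi aj bj) ⊎ (T (crossBlockᵇ ai bi aj bj) × n ∸ lcaSize 𝒯 i j ≤ card C)
  classify (inA _)       (inA _)       = inj₁ _
  classify (inB _)       (inB _)       = inj₁ _
  classify (inC _ _)     (inC _ _)     = inj₁ _
  classify (inA i∈a)     (inB j∈b) =
    inj₂ (_ , separated⇒n∸lcaSize≤|C| (a⊆H i∈a) (a-b-separated i∈a j∈b))
  classify (inB i∈b)     (inA j∈a) =
    inj₂ (_ , separated⇒n∸lcaSize≤|C|′ (a⊆H j∈a) (a-b-separated j∈a i∈b))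
  classify (inA i∈a)     (inC j∉a j∉b) =
    inj₂ (_ , separated⇒n∸lcaSize≤|C| (a⊆H i∈a) (outside-separated j∉a j∉b))
  classify (inB i∈b)     (inC j∉a j∉b) =
    inj₂ (_ , separated⇒n∸lcaSize≤|C| (b⊆H i∈b) (outside-separated j∉a j∉b))
  classify (inC i∉a i∉b) (inA j∈a) =
    inj₂ (_ , separated⇒n∸lcaSize≤|C|′ (a⊆H j∈a) (outside-separated i∉a i∉b))
  classify (inC i∉a i∉b) (inB j∈b) =
    inj₂ (_ , separated⇒n∸lcaSize≤|C|′ (b⊆H j∈b) (outside-separated i∉a i∉b))

  n∸lcaSize≤n∸2 : ∀ {i j} → i ≢ j → n ∸ lcaSize 𝒯 i j ≤ n ∸ 2
  n∸lcaSize≤n∸2 {i} {j} i≢j = ℕₚ.∸-monoʳ-≤ n (2≤lcaSize 𝒯 (𝒯-covers i) (𝒯-covers j) i≢j)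

  module _ (w : Fin n → Fin n → ℚ) (w-sym : ∀ i j → w i j ≡ w j i) (w-nonNeg : ∀ i j → 0ℚ ≤ℚ w i j) where

    within : Set' → Fin n → Fin n → ℚ
    within S i j = [ S i ∧ S j ]· w i j

    between : Set' → Set' → Fin n → Fin n → ℚ
    between S S′ i j = [ S i ∧ S′ j ]· w i j + [ S j ∧ S′ i ]· w j i

    withinParts crossParts : Fin n → Fin n → ℚ
    withinParts i j = within A i j + within B i j + within C i j
    crossParts  i j = between A B i j + between B C i j + between A C i j

    0≤withinParts : ∀ i j → 0ℚ ≤ℚ withinParts i j
    0≤withinParts i j = ℚₚ.+-mono-≤ (ℚₚ.+-mono-≤ (0≤within A) (0≤within B)) (0≤within C)
      where
      0≤within : ∀ S → 0ℚ ≤ℚ within S i j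
      0≤within S = []·-nonNeg (S i ∧ S j) (w-nonNeg i j)

    0≤crossParts : ∀ i j → 0ℚ ≤ℚ crossParts i j
    0≤crossParts i j = ℚₚ.+-mono-≤ (ℚₚ.+-mono-≤ (0≤between A B) (0≤between B C)) (0≤between A C)
      where
      0≤between : ∀ S S′ → 0ℚ ≤ℚ between S S′ i j
      0≤between S S′ = ℚₚ.+-mono-≤ ([]·-nonNeg (S i ∧ S′ j) (w-nonNeg i j)) ([]·-nonNeg (S j ∧ S′ i) (w-nonNeg j i))

    weight-split : ∀ i j → w i j ≤ℚ withinParts i j
                           ⊎ (w i j ≤ℚ crossParts i j × ℕtoℚ (n ∸ lcaSize 𝒯 i j) ≤ℚ ℕtoℚ (card C))
    weight-split i j with classify (part i) (part j)
    ... | inj₁ same = inj₁ (ℚₚ.≤-trans (T⇒≤[]· same) (sameBlock-≤ (A i) (B i) (A j) (B j) (w-nonNeg i j)))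
    ... | inj₂ (cross , far) =
      inj₂ ( ℚₚ.≤-trans (T⇒≤[]· cross)
               (crossBlock-≤ (A i) (B i) (A j) (B j) (w-nonNeg i j) (ℚₚ.≤-reflexive (w-sym i j)))
           , ℕtoℚ-mono-≤ far)

    pair-bound : ∀ i j → toℕ i < toℕ j →
                 w i j *ℚ ℕtoℚ (n ∸ lcaSize 𝒯 i j)
                   ≤ℚ withinParts i j *ℚ ℕtoℚ (n ∸ 2) + crossParts i j *ℚ ℕtoℚ (card C)
    pair-bound i j i<j =
      *-≤-split (0≤withinParts i j) (0≤crossParts i j) (0≤ℕtoℚ (n ∸ lcaSize 𝒯 i j)) (0≤ℕtoℚ (card C))
        (ℕtoℚ-mono-≤ (n∸lcaSize≤n∸2 (λ i≡j → ℕₚ.<⇒≢ i<j (cong toℕ i≡j)))) (weight-split i j)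

    pairSum-between-≤ : ∀ S S′ → pairSum (between S S′) ≤ℚ wBetween w S S′
    pairSum-between-≤ S S′ =
      pairSum-symmetrised-≤-fullSum (λ i j → [ S i ∧ S′ j ]· w i j)
                                    (λ i j → []·-nonNeg (S i ∧ S′ j) (w-nonNeg i j))

    F⁺-≤ : F⁺ w 𝒯 ≤ℚ (wIn w A + wIn w B + wIn w C) *ℚ ℕtoℚ (n ∸ 2)
                      + (wBetween w A B + wBetween w B C + wBetween w A C) *ℚ ℕtoℚ (card C)
    F⁺-≤ = begin
      F⁺ w 𝒯
        ≤⟨ pairSum-mono pair-bound ⟩
      pairSum (λ i j → withinParts i j *ℚ q + crossParts i j *ℚ r)
        ≡⟨ pairSum-+ (λ i j → withinParts i j *ℚ q) (λ i j → crossParts i j *ℚ r) ⟩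
      pairSum (λ i j → withinParts i j *ℚ q) + pairSum (λ i j → crossParts i j *ℚ r)
        ≡⟨ sym (cong₂ _+_ (pairSum-*ʳ withinParts q) (pairSum-*ʳ crossParts r)) ⟩
      pairSum withinParts *ℚ q + pairSum crossParts *ℚ r
        ≡⟨ cong₂ _+_ (cong (_*ℚ q) (pairSum-+₃ (within A) (within B) (within C)))
                      (cong (_*ℚ r) (pairSum-+₃ (between A B) (between B C) (between A C))) ⟩
      (wIn w A + wIn w B + wIn w C) *ℚ q
        + (pairSum (between A B) + pairSum (between B C) + pairSum (between A C)) *ℚ r
        ≤⟨ ℚₚ.+-monoʳ-≤ ((wIn w A + wIn w B + wIn w C) *ℚ q)
             (ℚₚ.*-monoʳ-≤-nonNeg r {{nonNegative (0≤ℕtoℚ (card C))}} cross-≤) ⟩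
      (wIn w A + wIn w B + wIn w C) *ℚ q + (wBetween w A B + wBetween w B C + wBetween w A C) *ℚ r ∎
      where
      open ℚₚ.≤-Reasoning
      q r : ℚ
      q = ℕtoℚ (n ∸ 2)
      r = ℕtoℚ (card C)
      cross-≤ : pairSum (between A B) + pairSum (between B C) + pairSum (between A C)
                ≤ℚ wBetween w A B + wBetween w B C + wBetween w A C
      cross-≤ = ℚₚ.+-mono-≤ (ℚₚ.+-mono-≤ (pairSum-between-≤ A B) (pairSum-between-≤ B C)) (pairSum-between-≤ A C)

RootedTreeOn⇒Unique : ∀ {n} (𝒯 : Tree n) → RootedTreeOn 𝒯 → Unique (leaves 𝒯)
RootedTreeOn⇒Unique {n} _ (_ , leaves↭V) =
  Unique-resp-↭ (setoid (Fin n)) (↭⇒↭ₛ (↭-sym leaves↭V)) (allFin⁺ n)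

RootedTreeOn⇒covers : ∀ {n} (𝒯 : Tree n) → RootedTreeOn 𝒯 → ∀ i → i ∈ leaves 𝒯
RootedTreeOn⇒covers _ (_ , leaves↭V) i = ∈-resp-↭ (↭-sym leaves↭V) (∈-allFin i)

proposition1 :
  (n : ℕ) (w : Fin n → Fin n → ℚ) →
  (∀ i j → w i j ≡ w j i) →
  (∀ i j → 0ℚ ≤ℚ w i j) →
  (T* : Tree n) → RootedTreeOn T* → Binary T* →
  (∀ T → RootedTreeOn T → F⁺ w T ≤ℚ F⁺ w T*) →
  (a b : Tree n) → node (a ∷ b ∷ []) ⊑ T* →
  n < 2 * length (leaves (node (a ∷ b ∷ []))) →
  2 * length (leaves a) ≤ n →
  2 * length (leaves b) ≤ n →
  let A = setOf (leaves a)
      B = setOf (leaves b)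
      C = λ i → not (A i ∨ B i)
  in F⁺ w T* ≤ℚ
       ((wIn w A + wIn w B + wIn w C) *ℚ ℕtoℚ (n ∸ 2))
       + ((wBetween w A B + wBetween w B C + wBetween w A C) *ℚ ℕtoℚ (card C))
proposition1 n w w-sym w-nonNeg T* T*-tree _ _ a b ab⊑T* _ _ _ =
  NodePartition.F⁺-≤ T* (RootedTreeOn⇒Unique T* T*-tree) (RootedTreeOn⇒covers T* T*-tree) a b ab⊑T* w w-sym w-nonNeg
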